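{- Let $m>2$ be an integer and $n=3m$. (1) For every $m$-circular $3m$-polygon there are integers $a,b,c$ with $a\neq b$ and $a\neq c$ such that, for a suitable starting vertex, its sequence of $n$ sides is $(a,b,c,\,a,b,c,\,\ldots,\,a,b,c)$ (block $(a,b,c)$ repeated $m$ times). (2) For every $m$-axial $3m$-polygon there are integers $a,b,c$ with $a\neq b$ and $a=c$ such that, for a suitable starting vertex, its sequence of $n$ sides is $(a,b,c,\,\ldots,\,a,b,c)$. (3) For every completely regular $3m$-polygon there are integers $a,b,c$ with $a=b=c$ such that its sequence of $n$ sides is $(a,b,c,\,\ldots,\,a,b,c)$.
   Context: Let $n\ge 3$ and $V_n=\{v_k=e^{2\pi i k/n}: k=0,\dots,n-1\}\subset\mathbb{C}$. An $n$-polygon is a closed polygonal path visiting every point of $V_n$ exactly once: for a cyclic ordering $(\sigma_1,\dots,\sigma_n)$ of $\{0,\dots,n-1\}$ (starting at vertex $v_{\sigma_1}$) it is the union of the segments $[v_{\sigma_i},v_{\sigma_{i+1}}]$, $i=1,\dots,n$, with $\sigma_{n+1}=\sigma_1$; its sequence of sides is $(e_1,\dots,e_n)$ with $e_i\in\{1,\dots,n-1\}$, $e_i\equiv\sigma_{i+1}-\sigma_i \pmod n$. A symmetry axis of an $n$-polygon is a line through $0$ such that reflection in it maps the polygon onto itself. For $m>2$, $n=3m$: an $m$-axial $3m$-polygon is a $3m$-polygon with exactly $m$ symmetry axes; an $m$-circular $3m$-polygon is a $3m$-polygon with no symmetry axis that is mapped onto itself by the rotations about $0$ through the angles $\frac{3\cdot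 2\pi i}{n}$, $i=1,\dots,m$; a completely regular $3m$-polygon is one with $n$ symmetry axes. -}

module Defs where

open import Data.Nat using (ℕ; zero; suc; _+_; _*_; _∸_; _<_; _≤_)
open import Data.Nat.DivMod using (_mod_; _%_)
open import Data.Fin using (Fin; toℕ)
open import Data.Fin.Subset using (Subset; _∈_; ∣_∣)
open import Data.Product using (Σ; ∃; ∃-syntax; _×_; _,_)
open import Data.Sum using (_⊎_)
open import Function.Bundles using (_⇔_)
open import Function.Definitions using (Bijective)
open import Relation.Binary.PropositionalEquality using (_≡_)
open import Relation.Nullary using (¬_)

-- Vertices v_k = e^{2πik/n} are represented by their index k ∈ {0,…,n-1}.
-- A cyclic ordering (σ_1,…,σ_n) is a bijection σ : Fin n → Fin n
-- (position i, 0-based, ↦ vertex index σ_{i+1}).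
IsPolygon : ∀ {n} → (Fin n → Fin n) → Set
IsPolygon σ = Bijective _≡_ _≡_ σ

-- reduction modulo n (junk value for n = 0)
_%ₙ_ : ℕ → ℕ → ℕ
i %ₙ zero = i
i %ₙ suc n = i % suc n

vtx : ∀ {n} → (Fin n → Fin n) → ℕ → ℕ
vtx {zero} σ i = 0
vtx {suc n} σ i = toℕ (σ (i mod suc n))

-- side i (0-based; this is e_{i+1} of the paper): (σ_{i+2} - σ_{i+1}) mod n
side : ∀ {n} → (Fin n → Fin n) → ℕ → ℕ
side {n} σ i = (vtx σ (suc i) + n ∸ vtx σ i) %ₙ n

IsEdge : ∀ {n} → (Fin n → Fin n) → ℕ → ℕ → Set
IsEdge {n} σ x y = ∃[ i ] (i < n × ((vtx σ i ≡ x × vtx σ (suc i) ≡ y)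
                                   ⊎ (vtx σ i ≡ y × vtx σ (suc i) ≡ x)))

PreservedBy : ∀ {n} → (Fin n → Fin n) → (ℕ → ℕ) → Set
PreservedBy {n} σ f = ∀ x y → x < n → y < n → (IsEdge σ x y ⇔ IsEdge σ (f x) (f y))

-- reflection in the line through 0 at angle πj/n : v_k ↦ v_{j-k}
reflect : ℕ → ℕ → ℕ → ℕ
reflect n j k = (j + n ∸ k) %ₙ n

-- rotation about 0 through angle 2πt/n : v_k ↦ v_{k+t}
rotate : ℕ → ℕ → ℕ → ℕ
rotate n t k = (k + t) %ₙ n

IsAxis : ∀ {n} → (Fin n → Fin n) → ℕ → Set
IsAxis {n} σ j = PreservedBy σ (reflect n j)

HasAxes : ∀ {n} → (Fin n → Fin n) → ℕ → Set
HasAxes {n} σ k = ∃[ S ] ((∀ (j : Fin n) → (j ∈ S ⇔ IsAxis σ (toℕ j))) × ∣ S ∣ ≡ k)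

Axial : ∀ m → (Fin (3 * m) → Fin (3 * m)) → Set
Axial m σ = HasAxes σ m

Circular : ∀ m → (Fin (3 * m) → Fin (3 * m)) → Set
Circular m σ = (∀ j → j < 3 * m → ¬ IsAxis σ j)
             × (∀ i → 1 ≤ i → i ≤ m → PreservedBy σ (rotate (3 * m) (3 * i)))

CompletelyRegular : ∀ m → (Fin (3 * m) → Fin (3 * m)) → Set
CompletelyRegular m σ = HasAxes σ (3 * m)

sel : ℕ → ℕ → ℕ → ℕ → ℕ
sel a b c 0 = a
sel a b c 1 = b
sel a b c _ = c

blk : ℕ → ℕ → ℕ → ℕ → ℕ
blk a b c i = sel a b c (i % 3)

SidesFrom : ∀ {n} → (Fin n → Fin n) → ℕ → ℕ → ℕ → ℕ → Set
SidesFrom {n} σ s a b c = ∀ i → i < n → side σ (s + i) ≡ blk a b c i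

-- A symmetry f of the polygon sends consecutive vertices to consecutive vertices, so on the positions
-- of the cyclic ordering it acts as i ↦ d + i or as i ↦ d - i. A rotation through 3 steps must act as a
-- translation i ↦ d + i, and since it has order m on the vertices, d generates 3ℤ/nℤ: the sides are
-- 3-periodic, i.e. (a, b, c, a, b, c, …) from any start. They are not all equal unless every line is an
-- axis. For an m-circular polygon a suitable start then gives a ≠ b and a ≠ c. For an m-axial polygon the
-- axes are closed under (a, b, c) ↦ a - b + c, hence form a coset of the multiples of their least gap h,
-- and counting them gives h = 3; the reflections in two axes 3 apart compose to the rotation by 3, and
-- one of them reverses positions, which forces a = c from a suitable start. For a completely regular
-- polygon the reflections in two adjacent axes compose to the rotation by one step, so all sides are equal.

module Submission where

open import Defs
open import Data.Nat
open import Data.Nat.Properties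
open import Data.Nat.DivMod
open import Data.Nat.Divisibility using (_∣_; _∣?_; divides; ∣-refl; _∣0; ∣⇒≤; ∣m+n∣m⇒∣n; ∣m∣n⇒∣m+n; m%n≡0⇒n∣m)
open import Data.Nat.Tactic.RingSolver
open import Data.Fin using (Fin; toℕ; fromℕ<; punchOut) renaming (zero to fzero; suc to fsuc)
open import Data.Fin.Properties using (any?; pigeonhole; punchOut-injective; toℕ<n; toℕ-injective; toℕ-fromℕ<)
import Data.Fin.Properties as Fin
open import Data.Fin.Subset using (Subset; _∈_; ∣_∣; ⊤; Nonempty)
open import Data.Fin.Subset.Properties using (_∈?_; nonempty?; Empty-unique; ∣⊥∣≡0; ∣⊤∣≡n; ⊆⊤; ⊆-antisym; ∣p∣≡n⇒p≡⊤; ∈⊤)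
open import Data.Vec using ([]; _∷_)
open import Data.Vec.Base using (here; there)
open import Data.Bool using (true; false)
open import Data.Empty using (⊥-elim)
open import Data.Product using (∃; ∃-syntax; _×_; _,_; proj₁; proj₂)
open import Data.Sum using (_⊎_; inj₁; inj₂; swap)
open import Function.Base using (_∘_; case_of_)
open import Function.Bundles using (_⇔_; mk⇔; Equivalence)
open import Level using (0ℓ)
open import Relation.Binary.Bundles using (Setoid)
import Relation.Binary.Reasoning.Setoid as SetoidReasoning
open import Relation.Binary.PropositionalEquality
open import Relation.Nullary using (¬_; Dec; yes; no)
open import Relation.Nullary.Decidable using (map′)
open import Relation.Unary using (Decidable)

-- Congruence modulo k

-- The space in [mod k ] is needed: k] would lex as a single name.
infix 4 _≡_[mod_]
_≡_[mod_] : ℕ → ℕ → ℕ → Set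
a ≡ b [mod k ] = ∃[ x ] ∃[ y ] (a + x * k ≡ b + y * k)

module _ {k : ℕ} where

  mod-reflexive : ∀ {a b} → a ≡ b → a ≡ b [mod k ]
  mod-reflexive refl = 0 , 0 , refl

  mod-refl : ∀ {a} → a ≡ a [mod k ]
  mod-refl = mod-reflexive refl

  mod-sym : ∀ {a b} → a ≡ b [mod k ] → b ≡ a [mod k ]
  mod-sym (x , y , eq) = y , x , sym eq

  mod-trans : ∀ {a b c} → a ≡ b [mod k ] → b ≡ c [mod k ] → a ≡ c [mod k ]
  mod-trans {a} {b} {c} (x , y , ab) (x′ , y′ , bc) = x + x′ , y′ + y , (begin
      a + (x + x′) * k      ≡⟨ regroup a x x′ k ⟩
      (a + x * k) + x′ * k  ≡⟨ cong (_+ x′ * k) ab ⟩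
      (b + y * k) + x′ * k  ≡⟨ exchange b y x′ k ⟩
      (b + x′ * k) + y * k  ≡⟨ cong (_+ y * k) bc ⟩
      (c + y′ * k) + y * k  ≡⟨ regroup c y′ y k ⟨
      c + (y′ + y) * k      ∎)
    where
    open ≡-Reasoning
    regroup : ∀ a x x′ k → a + (x + x′) * k ≡ (a + x * k) + x′ * k
    regroup = solve-∀
    exchange : ∀ b y x′ k → (b + y * k) + x′ * k ≡ (b + x′ * k) + y * k
    exchange = solve-∀

  mod-+-cong : ∀ {a b c d} → a ≡ b [mod k ] → c ≡ d [mod k ] → a + c ≡ b + d [mod k ]
  mod-+-cong {a} {b} {c} {d} (x , y , ab) (x′ , y′ , cd) = x + x′ , y + y′ , (begin
      a + c + (x + x′) * k        ≡⟨ regroup a c x x′ k ⟩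
      (a + x * k) + (c + x′ * k)  ≡⟨ cong₂ _+_ ab cd ⟩
      (b + y * k) + (d + y′ * k)  ≡⟨ regroup b d y y′ k ⟨
      b + d + (y + y′) * k        ∎)
    where
    open ≡-Reasoning
    regroup : ∀ a c x x′ k → a + c + (x + x′) * k ≡ (a + x * k) + (c + x′ * k)
    regroup = solve-∀

  mod-+-cancelʳ : ∀ {a b} c → a + c ≡ b + c [mod k ] → a ≡ b [mod k ]
  mod-+-cancelʳ {a} {b} c (x , y , eq) = x , y , +-cancelʳ-≡ c _ _ (begin
      a + x * k + c  ≡⟨ exchange a x k c ⟩
      a + c + x * k  ≡⟨ eq ⟩
      b + c + y * k  ≡⟨ exchange b y k c ⟨
      b + y * k + c  ∎)
    where
    open ≡-Reasoning
    exchange : ∀ a x k c → a + x * k + c ≡ a + c + x * k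
    exchange = solve-∀

  mod-+-cancelˡ : ∀ {a b} c → c + a ≡ c + b [mod k ] → a ≡ b [mod k ]
  mod-+-cancelˡ {a} {b} c eq = mod-+-cancelʳ c
    (subst₂ (λ x y → x ≡ y [mod k ]) (+-comm c a) (+-comm c b) eq)

  mod-+-multiple : ∀ a x → a + x * k ≡ a [mod k ]
  mod-+-multiple a x = 0 , x , +-identityʳ _

  mod-*-scale : ∀ c {a b} → a ≡ b [mod k ] → c * a ≡ c * b [mod c * k ]
  mod-*-scale c {a} {b} (x , y , eq) = x , y , (begin
      c * a + x * (c * k)  ≡⟨ distrib c a x k ⟩
      c * (a + x * k)      ≡⟨ cong (c *_) eq ⟩
      c * (b + y * k)      ≡⟨ distrib c b y k ⟨
      c * b + y * (c * k)  ∎)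
    where
    open ≡-Reasoning
    distrib : ∀ c a x k → c * a + x * (c * k) ≡ c * (a + x * k)
    distrib = solve-∀

  mod-*-unscale : ∀ c {a b} .{{_ : NonZero c}} → c * a ≡ c * b [mod c * k ] → a ≡ b [mod k ]
  mod-*-unscale c {a} {b} (x , y , eq) = x , y , *-cancelˡ-≡ _ _ c (begin
      c * (a + x * k)      ≡⟨ distrib c a x k ⟨
      c * a + x * (c * k)  ≡⟨ eq ⟩
      c * b + y * (c * k)  ≡⟨ distrib c b y k ⟩
      c * (b + y * k)      ∎)
    where
    open ≡-Reasoning
    distrib : ∀ c a x k → c * a + x * (c * k) ≡ c * (a + x * k)
    distrib = solve-∀

  module _ .{{_ : NonZero k}} where

    mod⇒%≡ : ∀ {a b} → a ≡ b [mod k ] → a % k ≡ b % k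
    mod⇒%≡ {a} {b} (x , y , eq) = begin
      a % k            ≡⟨ [m+kn]%n≡m%n a x k ⟨
      (a + x * k) % k  ≡⟨ cong (_% k) eq ⟩
      (b + y * k) % k  ≡⟨ [m+kn]%n≡m%n b y k ⟩
      b % k            ∎
      where open ≡-Reasoning

    %≡⇒mod : ∀ {a b} → a % k ≡ b % k → a ≡ b [mod k ]
    %≡⇒mod {a} {b} eq = b / k , a / k , (begin
      a + b / k * k                  ≡⟨ cong (_+ b / k * k) (m≡m%n+[m/n]*n a k) ⟩
      a % k + a / k * k + b / k * k  ≡⟨ cong (λ r → r + a / k * k + b / k * k) eq ⟩
      b % k + a / k * k + b / k * k  ≡⟨ exchange (b % k) (a / k * k) (b / k * k) ⟩
      b % k + b / k * k + a / k * k  ≡⟨ cong (_+ a / k * k) (m≡m%n+[m/n]*n b k) ⟨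
      b + a / k * k                  ∎)
      where
      open ≡-Reasoning
      exchange : ∀ r u v → r + u + v ≡ r + v + u
      exchange = solve-∀

    %-mod : ∀ a → a % k ≡ a [mod k ]
    %-mod a = %≡⇒mod (m%n%n≡m%n a k)

    mod-<⇒≡ : ∀ {a b} → a < k → b < k → a ≡ b [mod k ] → a ≡ b
    mod-<⇒≡ {a} {b} a<k b<k eq = begin
      a      ≡⟨ m<n⇒m%n≡m a<k ⟨
      a % k  ≡⟨ mod⇒%≡ eq ⟩
      b % k  ≡⟨ m<n⇒m%n≡m b<k ⟩
      b      ∎
      where open ≡-Reasoning

mod-setoid : ℕ → Setoid 0ℓ 0ℓ
mod-setoid k = record
  { Carrier       = ℕ
  ; _≈_           = λ a b → a ≡ b [mod k ]
  ; isEquivalence = record { refl = mod-refl ; sym = mod-sym ; trans = mod-trans }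
  }

injective⇒surjective : ∀ {k} (f : Fin k → Fin k) → (∀ {a b} → f a ≡ f b → a ≡ b) → ∀ y → ∃ λ x → f x ≡ y
injective⇒surjective {k} f inj y with any? (λ x → f x Fin.≟ y)
... | yes hit = hit
-- f misses y, so punching y out maps Fin (suc k) into Fin k, which forces a collision.
injective⇒surjective {suc k} f inj y | no miss = case pigeonhole (n<1+n k) (punchOut ∘ avoids) of λ
  { (i , j , i<j , collision) → ⊥-elim (Fin.<-irrefl (inj (punchOut-injective (avoids i) (avoids j) collision)) i<j) }
  where
  avoids : ∀ x → y ≢ f x
  avoids x eq = miss (x , sym eq)

module _ (m : ℕ) .{{_ : NonZero m}} where

  mod-invertible : ∀ q → 1 < m → (∀ a b → a < m → b < m → a * q ≡ b * q [mod m ] → a ≡ b) →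
                   ∃[ T ] T * q ≡ 1 [mod m ]
  mod-invertible q 1<m cancel = inverse (injective⇒surjective times-q times-q-injective (fromℕ< 1<m))
    where
    times-q : Fin m → Fin m
    times-q a = (toℕ a * q) mod m

    toℕ-times-q : ∀ a → toℕ (times-q a) ≡ (toℕ a * q) % m
    toℕ-times-q a = toℕ-fromℕ< _

    times-q-injective : ∀ {a b} → times-q a ≡ times-q b → a ≡ b
    times-q-injective {a} {b} eq = toℕ-injective (cancel (toℕ a) (toℕ b) (toℕ<n a) (toℕ<n b)
      (%≡⇒mod (trans (sym (toℕ-times-q a)) (trans (cong toℕ eq) (toℕ-times-q b)))))

    inverse : ∃ (λ T → times-q T ≡ fromℕ< 1<m) → ∃[ T ] T * q ≡ 1 [mod m ]
    inverse (T , T-hits-1) = toℕ T , %≡⇒mod (begin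
      (toℕ T * q) % m    ≡⟨ toℕ-times-q T ⟨
      toℕ (times-q T)    ≡⟨ cong toℕ T-hits-1 ⟩
      toℕ (fromℕ< 1<m)   ≡⟨ toℕ-fromℕ< 1<m ⟩
      1                  ≡⟨ m<n⇒m%n≡m 1<m ⟨
      1 % m              ∎)
      where open ≡-Reasoning

-- Counting

indicator : ∀ {A : Set} → Dec A → ℕ
indicator (yes _) = 1
indicator (no _)  = 0

count : ∀ {P : ℕ → Set} → Decidable P → ℕ → ℕ
count P? zero    = 0
count P? (suc K) = indicator (P? K) + count P? K

indicator-cong : ∀ {A B : Set} → (A → B) → (B → A) → (A? : Dec A) (B? : Dec B) → indicator A? ≡ indicator B?
indicator-cong f g (yes a) (yes b) = refl
indicator-cong f g (yes a) (no ¬b) = ⊥-elim (¬b (f a))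
indicator-cong f g (no ¬a) (yes b) = ⊥-elim (¬a (g b))
indicator-cong f g (no ¬a) (no ¬b) = refl

module _ {P Q : ℕ → Set} (P? : Decidable P) (Q? : Decidable Q) where

  count-cong : ∀ K → (∀ j → j < K → P j → Q j) → (∀ j → j < K → Q j → P j) → count P? K ≡ count Q? K
  count-cong zero    f g = refl
  count-cong (suc K) f g = cong₂ _+_ (indicator-cong (f K ≤-refl) (g K ≤-refl) (P? K) (Q? K))
    (count-cong K (λ j j<K → f j (m≤n⇒m≤1+n j<K)) (λ j j<K → g j (m≤n⇒m≤1+n j<K)))

module _ {P : ℕ → Set} (P? : Decidable P) where

  count-+ : ∀ a b → count P? (a + b) ≡ count P? a + count (λ j → P? (a + j)) b
  count-+ a zero    = trans (cong (count P?) (+-identityʳ a)) (sym (+-identityʳ _))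
  count-+ a (suc b) = begin
    count P? (a + suc b)                                 ≡⟨ cong (count P?) (+-suc a b) ⟩
    indicator (P? (a + b)) + count P? (a + b)            ≡⟨ cong (indicator (P? (a + b)) +_) (count-+ a b) ⟩
    indicator (P? (a + b)) + (count P? a + count P?′ b)  ≡⟨ left-comm (indicator (P? (a + b))) (count P? a) (count P?′ b) ⟩
    count P? a + (indicator (P? (a + b)) + count P?′ b)  ∎
    where
    open ≡-Reasoning
    P?′ : Decidable (λ j → P (a + j))
    P?′ j = P? (a + j)
    left-comm : ∀ x y z → x + (y + z) ≡ y + (x + z)
    left-comm = solve-∀

  count-periodic : ∀ h → (∀ j → P (h + j) → P j) → (∀ j → P j → P (h + j)) →
                   ∀ k → count P? (k * h) ≡ k * count P? h
  count-periodic h f g zero    = refl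
  count-periodic h f g (suc k) = begin
    count P? (h + k * h)                                 ≡⟨ count-+ h (k * h) ⟩
    count P? h + count (λ j → P? (h + j)) (k * h)        ≡⟨ cong (count P? h +_) (count-cong _ P? (k * h) (λ j _ → f j) (λ j _ → g j)) ⟩
    count P? h + count P? (k * h)                        ≡⟨ cong (count P? h +_) (count-periodic h f g k) ⟩
    count P? h + k * count P? h                          ∎
    where open ≡-Reasoning

  count-none : ∀ K → (∀ j → j < K → ¬ P j) → count P? K ≡ 0
  count-none zero    _ = refl
  count-none (suc K) none with P? K
  ... | yes p = ⊥-elim (none K ≤-refl p)
  ... | no _  = count-none K (λ j j<K → none j (m≤n⇒m≤1+n j<K))

  count-unique : ∀ K r → r < K → P r → (∀ j → j < K → P j → j ≡ r) → count P? K ≡ 1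
  count-unique (suc K) r r<K pr only with r ≟ K
  ... | yes refl with P? r
  ...   | yes _  = cong suc (count-none r (λ j j<r pj → <-irrefl (only j (m≤n⇒m≤1+n j<r) pj) j<r))
  ...   | no ¬pr = ⊥-elim (¬pr pr)
  count-unique (suc K) r r<K pr only | no r≢K with P? K
  ... | yes pK = ⊥-elim (r≢K (sym (only K ≤-refl pK)))
  ... | no _   = count-unique K r (≤∧≢⇒< (s≤s⁻¹ r<K) r≢K) pr (λ j j<K → only j (m≤n⇒m≤1+n j<K))

  count-rotate : ∀ K → (P K → P 0) → (P 0 → P K) → count (λ j → P? (suc j)) K ≡ count P? K
  count-rotate K f g = +-cancelˡ-≡ (indicator (P? K)) _ _ (begin
    indicator (P? K) + count (λ j → P? (suc j)) K  ≡⟨ cong (_+ count (λ j → P? (suc j)) K) (indicator-cong f g (P? K) (P? 0)) ⟩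
    indicator (P? 0) + count (λ j → P? (suc j)) K  ≡⟨ cong (_+ count (λ j → P? (suc j)) K) (+-identityʳ (indicator (P? 0))) ⟨
    count P? 1 + count (λ j → P? (suc j)) K        ≡⟨ count-+ 1 K ⟨
    count P? (1 + K)                               ∎)
    where open ≡-Reasoning

count-divisible-one-period : ∀ h .{{_ : NonZero h}} c → count (λ j → h ∣? (j + c)) h ≡ 1
count-divisible-one-period h zero = count-unique (λ j → h ∣? (j + 0)) h 0 (>-nonZero⁻¹ h) (h ∣0) only
  where
  only : ∀ j → j < h → h ∣ j + 0 → j ≡ 0
  only zero    _   _  = refl
  only (suc j) j<h h∣ = ⊥-elim (<-irrefl refl (<-≤-trans j<h (∣⇒≤ (subst (h ∣_) (+-identityʳ (suc j)) h∣))))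
count-divisible-one-period h (suc c) = begin
  count (λ j → h ∣? (j + suc c)) h  ≡⟨ count-cong (λ j → h ∣? (j + suc c)) (λ j → h ∣? (suc j + c)) h
                                         (λ j _ → subst (h ∣_) (+-suc j c)) (λ j _ → subst (h ∣_) (sym (+-suc j c))) ⟩
  count (λ j → h ∣? (suc j + c)) h  ≡⟨ count-rotate (λ j → h ∣? (j + c)) h (λ h∣ → ∣m+n∣m⇒∣n h∣ ∣-refl) (∣m∣n⇒∣m+n ∣-refl) ⟩
  count (λ j → h ∣? (j + c)) h      ≡⟨ count-divisible-one-period h c ⟩
  1                                 ∎
  where open ≡-Reasoning

count-divisible : ∀ h .{{_ : NonZero h}} c k → count (λ j → h ∣? (j + c)) (k * h) ≡ k
count-divisible h c k = begin
  count (λ j → h ∣? (j + c)) (k * h)  ≡⟨ count-periodic (λ j → h ∣? (j + c)) h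
                                           (λ j h∣ → ∣m+n∣m⇒∣n (subst (h ∣_) (+-assoc h j c) h∣) ∣-refl)
                                           (λ j h∣ → subst (h ∣_) (sym (+-assoc h j c)) (∣m∣n⇒∣m+n ∣-refl h∣)) k ⟩
  k * count (λ j → h ∣? (j + c)) h    ≡⟨ cong (k *_) (count-divisible-one-period h c) ⟩
  k * 1                               ≡⟨ *-identityʳ k ⟩
  k                                   ∎
  where open ≡-Reasoning

∣S∣≡count : ∀ {K} (S : Subset K) {P : ℕ → Set} (P? : Decidable P) → (∀ (j : Fin K) → j ∈ S ⇔ P (toℕ j)) → ∣ S ∣ ≡ count P? K
∣S∣≡count []           P? mem = refl
∣S∣≡count {suc K} (b ∷ S) {P} P? mem = begin
  ∣ b ∷ S ∣                                      ≡⟨ head b (Equivalence.to (mem fzero)) (Equivalence.from (mem fzero)) ⟩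
  indicator (P? 0) + count (λ j → P? (suc j)) K  ≡⟨ cong (_+ count (λ j → P? (suc j)) K) (+-identityʳ (indicator (P? 0))) ⟨
  count P? 1 + count (λ j → P? (suc j)) K        ≡⟨ count-+ P? 1 K ⟨
  count P? (1 + K)                               ∎
  where
  open ≡-Reasoning
  tail : ∣ S ∣ ≡ count (λ j → P? (suc j)) K
  tail = ∣S∣≡count S (λ j → P? (suc j))
    (λ j → mk⇔ (λ j∈S → Equivalence.to (mem (fsuc j)) (there j∈S)) (λ p → drop-there (Equivalence.from (mem (fsuc j)) p)))
    where
    drop-there : ∀ {j} → fsuc j ∈ b ∷ S → j ∈ S
    drop-there (there j∈S) = j∈S
  head : ∀ b → (fzero ∈ b ∷ S → P 0) → (P 0 → fzero ∈ b ∷ S) → ∣ b ∷ S ∣ ≡ indicator (P? 0) + count (λ j → P? (suc j)) K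
  head true  f g with P? 0
  ... | yes _  = cong suc tail
  ... | no ¬p0 = ⊥-elim (¬p0 (f here))
  head false f g with P? 0
  ... | yes p0 = case g p0 of λ ()
  ... | no _   = tail

least-witness : ∀ {P : ℕ → Set} → Decidable P → ∀ K → P K → ∃[ h ] (P h × ∀ t → t < h → ¬ P t)
least-witness P? zero    pK = 0 , pK , λ t ()
least-witness P? (suc K) pK with P? 0
... | yes p0 = 0 , p0 , λ t ()
... | no ¬p0 with least-witness (λ j → P? (suc j)) K pK
...   | h , ph , below = suc h , ph , λ { zero _ → ¬p0 ; (suc t) (s≤s t<h) → below t t<h }

blk-constant : ∀ a i → blk a a a i ≡ a
blk-constant a i with i % 3
... | 0           = refl
... | 1           = refl
... | suc (suc _) = refl

module Periodic (f : ℕ → ℕ) (period : ∀ i → f (3 + i) ≡ f i) where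

  periodic-multiple : ∀ k i → f (k * 3 + i) ≡ f i
  periodic-multiple zero    i = refl
  periodic-multiple (suc k) i = begin
    f (3 + k * 3 + i)    ≡⟨ cong f (+-assoc 3 (k * 3) i) ⟩
    f (3 + (k * 3 + i))  ≡⟨ period (k * 3 + i) ⟩
    f (k * 3 + i)        ≡⟨ periodic-multiple k i ⟩
    f i                  ∎
    where open ≡-Reasoning

  periodic⇒blk : ∀ s i → f (s + i) ≡ blk (f s) (f (1 + s)) (f (2 + s)) i
  periodic⇒blk s i = begin
    f (s + i)                            ≡⟨ cong (λ j → f (s + j)) (m≡m%n+[m/n]*n i 3) ⟩
    f (s + (i % 3 + i / 3 * 3))          ≡⟨ cong f (regroup s (i % 3) (i / 3)) ⟩
    f (i / 3 * 3 + (s + i % 3))          ≡⟨ periodic-multiple (i / 3) (s + i % 3) ⟩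
    f (s + i % 3)                        ≡⟨ within-block (i % 3) (m%n<n i 3) ⟩
    blk (f s) (f (1 + s)) (f (2 + s)) i  ∎
    where
    open ≡-Reasoning
    regroup : ∀ s r q → s + (r + q * 3) ≡ q * 3 + (s + r)
    regroup = solve-∀
    within-block : ∀ r → r < 3 → f (s + r) ≡ sel (f s) (f (1 + s)) (f (2 + s)) r
    within-block 0 _ = cong f (+-identityʳ s)
    within-block 1 _ = cong f (+-comm s 1)
    within-block 2 _ = cong f (+-comm s 2)
    within-block (suc (suc (suc r))) (s≤s (s≤s (s≤s ())))

  periodic-constant : ∀ s → f s ≡ f (1 + s) → f s ≡ f (2 + s) → ∀ i → f i ≡ f s
  periodic-constant s f1 f2 i = begin
    f i                                  ≡⟨ periodic-multiple s i ⟨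
    f (s * 3 + i)                        ≡⟨ cong f (regroup s i) ⟩
    f (s + (s * 2 + i))                  ≡⟨ periodic⇒blk s (s * 2 + i) ⟩
    blk (f s) (f (1 + s)) (f (2 + s)) (s * 2 + i)  ≡⟨ cong₂ (λ b c → blk (f s) b c (s * 2 + i)) (sym f1) (sym f2) ⟩
    blk (f s) (f s) (f s) (s * 2 + i)    ≡⟨ blk-constant (f s) (s * 2 + i) ⟩
    f s                                  ∎
    where
    open ≡-Reasoning
    regroup : ∀ s i → s * 3 + i ≡ s + (s * 2 + i)
    regroup = solve-∀

  distinct-in-block : ¬ (f 0 ≡ f 1 × f 0 ≡ f 2) → ∃[ s ] (s < 3 × f s ≢ f (1 + s) × f s ≢ f (2 + s))
  distinct-in-block not-constant with f 0 ≟ f 1 | f 0 ≟ f 2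
  ... | no f0≢f1  | no f0≢f2  = 0 , s≤s z≤n , f0≢f1 , f0≢f2
  ... | yes f0≡f1 | yes f0≡f2 = ⊥-elim (not-constant (f0≡f1 , f0≡f2))
  ... | yes f0≡f1 | no f0≢f2  = 2 , ≤-refl , (λ eq → f0≢f2 (sym (trans eq (period 0))))
                                           , (λ eq → f0≢f2 (trans f0≡f1 (sym (trans eq (period 1)))))
  ... | no f0≢f1  | yes f0≡f2 = 1 , s≤s (s≤s z≤n) , (λ eq → f0≢f1 (trans f0≡f2 (sym eq)))
                                           , (λ eq → f0≢f1 (sym (trans eq (period 0))))

module Polygon {N : ℕ} (σ : Fin (suc N) → Fin (suc N)) (polygon : IsPolygon σ) where

  n : ℕ
  n = suc N

  v : ℕ → ℕ
  v = vtx σ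

  e : ℕ → ℕ
  e = side σ

  module mod-Reasoning = SetoidReasoning (mod-setoid n)

  v-< : ∀ i → v i < n
  v-< i = toℕ<n _

  v-cong : ∀ {i j} → i ≡ j [mod n ] → v i ≡ v j
  v-cong {i} {j} i≡j = cong (toℕ ∘ σ) (toℕ-injective (begin
    toℕ (i mod n)  ≡⟨ toℕ-fromℕ< _ ⟩
    i % n          ≡⟨ mod⇒%≡ i≡j ⟩
    j % n          ≡⟨ toℕ-fromℕ< _ ⟨
    toℕ (j mod n)  ∎))
    where open ≡-Reasoning

  v-injective : ∀ {i j} → v i ≡ v j → i ≡ j [mod n ]
  v-injective {i} {j} eq = %≡⇒mod (begin
    i % n          ≡⟨ toℕ-fromℕ< _ ⟨
    toℕ (i mod n)  ≡⟨ cong toℕ (proj₁ polygon (toℕ-injective eq)) ⟩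
    toℕ (j mod n)  ≡⟨ toℕ-fromℕ< _ ⟩
    j % n          ∎)
    where open ≡-Reasoning

  v-surjective : ∀ {x} → x < n → ∃[ i ] v i ≡ x
  v-surjective {x} x<n with proj₂ polygon (fromℕ< x<n)
  ... | p , hits = toℕ p , (begin
    v (toℕ p)         ≡⟨ cong toℕ (hits (toℕ-injective (trans (toℕ-fromℕ< _) (m<n⇒m%n≡m (toℕ<n p))))) ⟩
    toℕ (fromℕ< x<n)  ≡⟨ toℕ-fromℕ< x<n ⟩
    x                 ∎)
    where open ≡-Reasoning

  ≢0-mod : ∀ {a} → 0 < a → a < n → ¬ a ≡ 0 [mod n ]
  ≢0-mod 0<a a<n a≡0 = <-irrefl (sym (mod-<⇒≡ a<n (s≤s z≤n) a≡0)) 0<a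

  edge-forward : ∀ p → IsEdge σ (v p) (v (suc p))
  edge-forward p = p % n , m%n<n p n , inj₁ (v-cong (%-mod p) , v-cong (mod-+-cong {a = 1} mod-refl (%-mod p)))

  edge-neighbours : ∀ p {y} → IsEdge σ (v p) y → y ≡ v (p + 1) ⊎ y ≡ v (p + N)
  edge-neighbours p (i , _ , inj₁ (vi≡vp , vi+1≡y)) =
    inj₁ (trans (sym vi+1≡y) (v-cong (mod-trans (mod-+-cong {a = 1} mod-refl (v-injective vi≡vp)) (mod-reflexive (+-comm 1 p)))))
  edge-neighbours p (i , _ , inj₂ (vi≡y , vi+1≡vp)) = inj₂ (trans (sym vi≡y) (v-cong i≡p-1))
    where
    open mod-Reasoning
    i≡p-1 : i ≡ p + N [mod n ]
    i≡p-1 = begin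
      i          ≈⟨ mod-+-multiple i 1 ⟨
      i + 1 * n  ≡⟨ cong (i +_) (*-identityˡ n) ⟩
      i + n      ≡⟨ +-suc i N ⟩
      suc i + N  ≈⟨ mod-+-cong (v-injective {suc i} {p} vi+1≡vp) mod-refl ⟩
      p + N      ∎

  edge-sym : ∀ {x y} → IsEdge σ x y → IsEdge σ y x
  edge-sym (i , i<n , inj₁ (a , b)) = i , i<n , inj₂ (a , b)
  edge-sym (i , i<n , inj₂ (a , b)) = i , i<n , inj₁ (a , b)

  e-< : ∀ i → e i < n
  e-< i = m%n<n (v (suc i) + n ∸ v i) n

  v+e : ∀ i → v i + e i ≡ v (suc i) [mod n ]
  v+e i = begin
    v i + e i          ≈⟨ mod-+-cong (mod-refl {a = v i}) (%-mod (v (suc i) + n ∸ v i)) ⟩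
    v i + (v (suc i) + n ∸ v i)  ≡⟨ +-comm (v i) _ ⟩
    v (suc i) + n ∸ v i + v i    ≡⟨ m∸n+n≡m (≤-trans (<⇒≤ (v-< i)) (m≤n+m n (v (suc i)))) ⟩
    v (suc i) + n      ≡⟨ cong (v (suc i) +_) (*-identityˡ n) ⟨
    v (suc i) + 1 * n  ≈⟨ mod-+-multiple (v (suc i)) 1 ⟩
    v (suc i)          ∎
    where open mod-Reasoning

  e-unique : ∀ {i r} → r < n → v i + r ≡ v (suc i) [mod n ] → e i ≡ r
  e-unique {i} r<n vi+r≡ = mod-<⇒≡ (e-< i) r<n (mod-+-cancelˡ (v i) (mod-trans (v+e i) (mod-sym vi+r≡)))

  e-cong : ∀ {i j} → i ≡ j [mod n ] → e i ≡ e j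
  e-cong {i} {j} i≡j = sym (e-unique (e-< i) (begin
    v j + e i   ≡⟨ cong (_+ e i) (v-cong (mod-sym i≡j)) ⟩
    v i + e i   ≈⟨ v+e i ⟩
    v (suc i)   ≡⟨ v-cong (mod-+-cong {a = 1} mod-refl i≡j) ⟩
    v (suc j)   ∎))
    where open mod-Reasoning

  preserved-cong : ∀ {f g : ℕ → ℕ} → (∀ x → x < n → f x ≡ g x) → PreservedBy σ f → PreservedBy σ g
  preserved-cong f≗g f-pres x y x<n y<n = mk⇔
    (λ xy → subst₂ (IsEdge σ) (f≗g x x<n) (f≗g y y<n) (Equivalence.to (f-pres x y x<n y<n) xy))
    (λ gxy → Equivalence.from (f-pres x y x<n y<n) (subst₂ (IsEdge σ) (sym (f≗g x x<n)) (sym (f≗g y y<n)) gxy))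

  preserved-∘ : ∀ {f g : ℕ → ℕ} → (∀ x → x < n → f x < n) → PreservedBy σ f → PreservedBy σ g → PreservedBy σ (g ∘ f)
  preserved-∘ {f} f-< f-pres g-pres x y x<n y<n = mk⇔
    (Equivalence.to (g-pres (f x) (f y) (f-< x x<n) (f-< y y<n)) ∘ Equivalence.to (f-pres x y x<n y<n))
    (Equivalence.from (f-pres x y x<n y<n) ∘ Equivalence.from (g-pres (f x) (f y) (f-< x x<n) (f-< y y<n)))

  involution-preserved : ∀ {f : ℕ → ℕ} → (∀ x → x < n → f x < n) → (∀ x → x < n → f (f x) ≡ x) →
                         (∀ x y → x < n → y < n → IsEdge σ x y → IsEdge σ (f x) (f y)) → PreservedBy σ f
  involution-preserved {f} f-< f-invol f-edge x y x<n y<n = mk⇔ (f-edge x y x<n y<n)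
    (λ fxy → subst₂ (IsEdge σ) (f-invol x x<n) (f-invol y y<n) (f-edge (f x) (f y) (f-< x x<n) (f-< y y<n) fxy))

  rotate-< : ∀ t x → rotate n t x < n
  rotate-< t x = m%n<n (x + t) n

  reflect-< : ∀ j x → reflect n j x < n
  reflect-< j x = m%n<n (j + n ∸ x) n

  rotate-mod : ∀ t x → rotate n t x ≡ x + t [mod n ]
  rotate-mod t x = %-mod (x + t)

  reflect-mod : ∀ j {x} → x < n → reflect n j x + x ≡ j [mod n ]
  reflect-mod j {x} x<n = begin
    reflect n j x + x  ≈⟨ mod-+-cong (%-mod (j + n ∸ x)) mod-refl ⟩
    j + n ∸ x + x      ≡⟨ m∸n+n≡m (≤-trans (<⇒≤ x<n) (m≤n+m n j)) ⟩
    j + n              ≡⟨ cong (j +_) (*-identityˡ n) ⟨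
    j + 1 * n          ≈⟨ mod-+-multiple j 1 ⟩
    j                  ∎
    where open mod-Reasoning

  rotate-injective : ∀ t x y → x < n → y < n → rotate n t x ≡ rotate n t y → x ≡ y
  rotate-injective t x y x<n y<n eq = mod-<⇒≡ x<n y<n (mod-+-cancelʳ t (begin
    x + t          ≈⟨ rotate-mod t x ⟨
    rotate n t x   ≡⟨ eq ⟩
    rotate n t y   ≈⟨ rotate-mod t y ⟩
    y + t          ∎))
    where open mod-Reasoning

  reflect-injective : ∀ j x y → x < n → y < n → reflect n j x ≡ reflect n j y → x ≡ y
  reflect-injective j x y x<n y<n eq = mod-<⇒≡ x<n y<n (mod-+-cancelˡ (reflect n j x) (begin
    reflect n j x + x  ≈⟨ reflect-mod j x<n ⟩
    j                  ≈⟨ reflect-mod j y<n ⟨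
    reflect n j y + y  ≡⟨ cong (_+ y) eq ⟨
    reflect n j x + y  ∎))
    where open mod-Reasoning

  reflect-involutive : ∀ j x → x < n → reflect n j (reflect n j x) ≡ x
  reflect-involutive j x x<n = mod-<⇒≡ (reflect-< j (reflect n j x)) x<n (mod-+-cancelˡ (reflect n j x) (begin
    reflect n j x + reflect n j (reflect n j x)  ≡⟨ +-comm (reflect n j x) _ ⟩
    reflect n j (reflect n j x) + reflect n j x  ≈⟨ reflect-mod j (reflect-< j x) ⟩
    j                                            ≈⟨ reflect-mod j x<n ⟨
    reflect n j x + x                            ∎))
    where open mod-Reasoning

  axis-cong : ∀ {j j′} → j ≡ j′ [mod n ] → IsAxis σ j → IsAxis σ j′
  axis-cong {j} {j′} j≡j′ = preserved-cong λ x x<n → mod-<⇒≡ (reflect-< j x) (reflect-< j′ x) (mod-+-cancelʳ x (begin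
    reflect n j x + x   ≈⟨ reflect-mod j x<n ⟩
    j                   ≈⟨ j≡j′ ⟩
    j′                  ≈⟨ reflect-mod j′ x<n ⟨
    reflect n j′ x + x  ∎))
    where open mod-Reasoning

  reflect∘reflect : ∀ a t x → x < n → reflect n (a + t) (reflect n a x) ≡ rotate n t x
  reflect∘reflect a t x x<n = mod-<⇒≡ (reflect-< (a + t) r) (rotate-< t x) (mod-+-cancelʳ a (begin
    r′ + a             ≈⟨ mod-+-cong (mod-refl {a = r′}) (reflect-mod a x<n) ⟨
    r′ + (r + x)       ≡⟨ +-assoc r′ r x ⟨
    r′ + r + x         ≈⟨ mod-+-cong (reflect-mod (a + t) (reflect-< a x)) mod-refl ⟩
    a + t + x          ≡⟨ regroup a t x ⟩
    x + t + a          ≈⟨ mod-+-cong (rotate-mod t x) mod-refl ⟨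
    rotate n t x + a   ∎))
    where
    open mod-Reasoning
    r r′ : ℕ
    r = reflect n a x
    r′ = reflect n (a + t) r
    regroup : ∀ a t x → a + t + x ≡ x + t + a
    regroup = solve-∀

  rotation-from-axes : ∀ a t → IsAxis σ a → IsAxis σ (a + t) → PreservedBy σ (rotate n t)
  rotation-from-axes a t a-axis a+t-axis =
    preserved-cong (reflect∘reflect a t) (preserved-∘ (λ x _ → reflect-< a x) a-axis a+t-axis)

  -- The composite of the reflections in a, b and c is the reflection in a - b + c.
  axis-reflect : ∀ a b c → IsAxis σ a → IsAxis σ b → IsAxis σ c → IsAxis σ (a + c + N * b)
  axis-reflect a b c a-axis b-axis c-axis =
    preserved-cong composite (preserved-∘ (λ x _ → reflect-< c x) c-axis (preserved-∘ (λ x _ → reflect-< b x) b-axis a-axis))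
    where
    composite : ∀ x → x < n → reflect n a (reflect n b (reflect n c x)) ≡ reflect n (a + c + N * b) x
    composite x x<n = mod-<⇒≡ (reflect-< a rb) (reflect-< (a + c + N * b) x) (mod-+-cancelʳ x (mod-+-cancelʳ b (begin
      ra + x + b                           ≈⟨ mod-+-cong (mod-refl {a = ra + x}) (reflect-mod b (reflect-< c x)) ⟨
      ra + x + (rb + rc)                   ≡⟨ regroup ra x rb rc ⟩
      (ra + rb) + (rc + x)                 ≈⟨ mod-+-cong (reflect-mod a (reflect-< b rc)) (reflect-mod c x<n) ⟩
      a + c                                ≈⟨ mod-+-multiple (a + c) b ⟨
      a + c + b * n                        ≡⟨ expand a c N b ⟩
      a + c + N * b + b                    ≈⟨ mod-+-cong (reflect-mod (a + c + N * b) x<n) mod-refl ⟨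
      reflect n (a + c + N * b) x + x + b  ∎)))
      where
      open mod-Reasoning
      rc rb ra : ℕ
      rc = reflect n c x
      rb = reflect n b rc
      ra = reflect n a rb
      regroup : ∀ z x u w → z + x + (u + w) ≡ (z + u) + (w + x)
      regroup = solve-∀
      expand : ∀ a c N b → a + c + b * suc N ≡ a + c + N * b + b
      expand = solve-∀

  1+N≡0 : 1 + N ≡ 0 [mod n ]
  1+N≡0 = subst (λ k → k ≡ 0 [mod n ]) (+-identityʳ n) (mod-+-multiple 0 1)

  Translates : (ℕ → ℕ) → ℕ → Set
  Translates f d = ∀ i → f (v i) ≡ v (d + i)

  -- position i goes to d - i, as N * i ≡ - i modulo n
  Reverses : (ℕ → ℕ) → ℕ → Set
  Reverses f d = ∀ i → f (v i) ≡ v (d + N * i)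

  reverses-involutive : ∀ {f d} → Reverses f d → ∀ i → f (f (v i)) ≡ v i
  reverses-involutive {f} {d} rev i = begin
    f (f (v i))              ≡⟨ cong f (rev i) ⟩
    f (v (d + N * i))        ≡⟨ rev (d + N * i) ⟩
    v (d + N * (d + N * i))  ≡⟨ v-cong (2 * i , d + n * i , square d N i) ⟩
    v i                      ∎
    where
    open ≡-Reasoning
    square : ∀ d N i → d + N * (d + N * i) + 2 * i * suc N ≡ i + (d + suc N * i) * suc N
    square = solve-∀

  module _ {f : ℕ → ℕ} (f-< : ∀ x → x < n → f x < n) (f-injective : ∀ x y → x < n → y < n → f x ≡ f y → x ≡ y)
           (f-preserved : PreservedBy σ f) where

    f-edge : ∀ i → IsEdge σ (f (v i)) (f (v (suc i)))
    f-edge i = Equivalence.to (f-preserved (v i) (v (suc i)) (v-< i) (v-< (suc i))) (edge-forward i)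

    -- Once f is known on two consecutive positions, injectivity forbids it to turn back.
    follow : 2 < n → ∀ d u u′ → u + u′ ≡ 0 [mod n ] → (∀ p {y} → IsEdge σ (v p) y → y ≡ v (p + u) ⊎ y ≡ v (p + u′)) →
             f (v 0) ≡ v d → f (v 1) ≡ v (d + u) → ∀ i → f (v i) ≡ v (d + u * i)
    follow 2<n d u u′ u+u′≡0 neighbours f0 f1 i = proj₁ (consecutive i)
      where
      P : ℕ → Set
      P i = f (v i) ≡ v (d + u * i)

      step : ∀ i → P i → P (suc i) → P (suc (suc i))
      step i Pi Pi+1 with neighbours (d + u * suc i) (subst (λ z → IsEdge σ z (f (v (2 + i)))) Pi+1 (f-edge (suc i)))
      ... | inj₁ forward  = trans forward (cong v (advance d u i))
        where
        advance : ∀ d u i → d + u * suc i + u ≡ d + u * suc (suc i)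
        advance = solve-∀
      ... | inj₂ backward = ⊥-elim (≢0-mod (s≤s z≤n) 2<n (mod-+-cancelˡ i (begin
          i + 2     ≡⟨ +-comm i 2 ⟩
          2 + i     ≈⟨ v-injective (f-injective _ _ (v-< (2 + i)) (v-< i) (trans backward (trans (v-cong back) (sym Pi)))) ⟩
          i         ≡⟨ +-identityʳ i ⟨
          i + 0     ∎)))
        where
        open mod-Reasoning
        back : d + u * suc i + u′ ≡ d + u * i [mod n ]
        back = begin
          d + u * suc i + u′       ≡⟨ regroup d u i u′ ⟩
          d + u * i + (u + u′)     ≈⟨ mod-+-cong (mod-refl {a = d + u * i}) u+u′≡0 ⟩
          d + u * i + 0            ≡⟨ +-identityʳ _ ⟩
          d + u * i                ∎
          where
          regroup : ∀ d u i u′ → d + u * suc i + u′ ≡ d + u * i + (u + u′)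
          regroup = solve-∀

      consecutive : ∀ i → P i × P (suc i)
      consecutive zero    = trans f0 (cong v (at0 d u)) , trans f1 (cong v (at1 d u))
        where
        at0 : ∀ d u → d ≡ d + u * 0
        at0 = solve-∀
        at1 : ∀ d u → d + u ≡ d + u * 1
        at1 = solve-∀
      consecutive (suc i) = let (Pi , Pi+1) = consecutive i in Pi+1 , step i Pi Pi+1

    acts-on-positions : 2 < n → ∃[ d ] (Translates f d ⊎ Reverses f d)
    acts-on-positions 2<n with v-surjective (f-< (v 0) (v-< 0))
    ... | d , vd≡f0 with edge-neighbours d (subst (λ z → IsEdge σ z (f (v 1))) (sym vd≡f0) (f-edge 0))
    ... | inj₁ f1≡ = d , inj₁ λ i →
      trans (follow 2<n d 1 N 1+N≡0 edge-neighbours (sym vd≡f0) f1≡ i) (cong (λ k → v (d + k)) (*-identityˡ i))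
    ... | inj₂ f1≡ = d , inj₂
      (follow 2<n d N 1 (mod-trans (mod-reflexive (+-comm N 1)) 1+N≡0) (λ p edge → swap (edge-neighbours p edge)) (sym vd≡f0) f1≡)

  rotate-twice-fixes : ∀ t x → x < n → rotate n t (rotate n t x) ≡ x → t + t ≡ 0 [mod n ]
  rotate-twice-fixes t x x<n fixes = mod-+-cancelˡ x (begin
    x + (t + t)                ≡⟨ +-assoc x t t ⟨
    x + t + t                  ≈⟨ mod-+-cong (rotate-mod t x) mod-refl ⟨
    rotate n t x + t           ≈⟨ rotate-mod t (rotate n t x) ⟨
    rotate n t (rotate n t x)  ≡⟨ fixes ⟩
    x                          ≡⟨ +-identityʳ x ⟨
    x + 0                      ∎)
    where open mod-Reasoning

  rotation-translates : 2 < n → ∀ t → 0 < t + t → t + t < n → PreservedBy σ (rotate n t) → ∃[ d ] Translates (rotate n t) d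
  rotation-translates 2<n t 0<2t 2t<n preserved =
    translation (acts-on-positions (λ x _ → rotate-< t x) (rotate-injective t) preserved 2<n)
    where
    translation : ∃[ d ] (Translates (rotate n t) d ⊎ Reverses (rotate n t) d) → ∃[ d ] Translates (rotate n t) d
    translation (d , inj₁ translates) = d , translates
    translation (d , inj₂ reverses)   =
      ⊥-elim (≢0-mod 0<2t 2t<n (rotate-twice-fixes t (v 0) (v-< 0) (reverses-involutive {rotate n t} {d} reverses 0)))

  module _ {t d : ℕ} (translates : Translates (rotate n t) d) where

    v-translate : ∀ i → v (d + i) ≡ v i + t [mod n ]
    v-translate i = mod-trans (mod-reflexive (sym (translates i))) (rotate-mod t (v i))

    v-translate-multiple : ∀ k i → v (k * d + i) ≡ v i + k * t [mod n ]
    v-translate-multiple zero    i = mod-reflexive (sym (+-identityʳ (v i)))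
    v-translate-multiple (suc k) i = begin
      v (d + k * d + i)      ≡⟨ cong v (+-assoc d (k * d) i) ⟩
      v (d + (k * d + i))    ≈⟨ v-translate (k * d + i) ⟩
      v (k * d + i) + t      ≈⟨ mod-+-cong (v-translate-multiple k i) mod-refl ⟩
      v i + k * t + t        ≡⟨ regroup (v i) k t ⟩
      v i + (t + k * t)      ∎
      where
      open mod-Reasoning
      regroup : ∀ a k t → a + k * t + t ≡ a + (t + k * t)
      regroup = solve-∀

    e-translate : ∀ i → e (d + i) ≡ e i
    e-translate i = e-unique (e-< i) (begin
      v (d + i) + e i      ≈⟨ mod-+-cong (v-translate i) mod-refl ⟩
      v i + t + e i        ≡⟨ regroup (v i) t (e i) ⟩
      v i + e i + t        ≈⟨ mod-+-cong (v+e i) mod-refl ⟩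
      v (suc i) + t        ≈⟨ v-translate (suc i) ⟨
      v (d + suc i)        ≡⟨ cong v (+-suc d i) ⟩
      v (suc (d + i))      ∎)
      where
      open mod-Reasoning
      regroup : ∀ a b c → a + b + c ≡ a + c + b
      regroup = solve-∀

    e-translate-multiple : ∀ k i → e (k * d + i) ≡ e i
    e-translate-multiple zero    i = refl
    e-translate-multiple (suc k) i = begin
      e (d + k * d + i)    ≡⟨ cong e (+-assoc d (k * d) i) ⟩
      e (d + (k * d + i))  ≡⟨ e-translate (k * d + i) ⟩
      e (k * d + i)        ≡⟨ e-translate-multiple k i ⟩
      e i                  ∎
      where open ≡-Reasoning

  e-reverse : ∀ {a d} → Reverses (reflect n a) d → ∀ i → e (d + N * suc i) ≡ e i
  e-reverse {a} {d} reverses i = e-unique (e-< i) (mod-+-cancelʳ (v i) (begin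
    v k + e i + v i                      ≡⟨ +-assoc (v k) (e i) (v i) ⟩
    v k + (e i + v i)                    ≡⟨ cong (v k +_) (+-comm (e i) (v i)) ⟩
    v k + (v i + e i)                    ≈⟨ mod-+-cong (mod-refl {a = v k}) (v+e i) ⟩
    v k + v (suc i)                      ≡⟨ cong (_+ v (suc i)) (reverses (suc i)) ⟨
    reflect n a (v (suc i)) + v (suc i)  ≈⟨ reflect-mod a (v-< (suc i)) ⟩
    a                                    ≈⟨ reflect-mod a (v-< i) ⟨
    reflect n a (v i) + v i              ≡⟨ cong (_+ v i) (reverses i) ⟩
    v (d + N * i) + v i                  ≡⟨ cong (_+ v i) (v-cong (1 , 0 , wrap d N i)) ⟩
    v (suc k) + v i                      ∎))
    where
    open mod-Reasoning
    k : ℕ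
    k = d + N * suc i
    wrap : ∀ d N i → d + N * i + 1 * suc N ≡ suc (d + N * suc i) + 0 * suc N
    wrap = solve-∀

  constant-sides⇒axis : ∀ E → (∀ i → e i ≡ E) → ∀ j → IsAxis σ j
  constant-sides⇒axis E constant j = involution-preserved (λ x _ → reflect-< j x) (reflect-involutive j) reflects-edge
    where
    v-step : ∀ p → v p + E ≡ v (suc p) [mod n ]
    v-step p = mod-trans (mod-reflexive (cong (v p +_) (sym (constant p)))) (v+e p)

    -- all sides being equal, the mirror image of the side leaving v i is the side entering its mirror image
    mirror-edge : ∀ i → IsEdge σ (reflect n j (v i)) (reflect n j (v (suc i)))
    mirror-edge i = from (v-surjective (reflect-< j (v i)))
      where
      from : ∃[ k ] v k ≡ reflect n j (v i) → IsEdge σ (reflect n j (v i)) (reflect n j (v (suc i)))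
      from (k , vk≡) = subst₂ (IsEdge σ) (trans (v-cong k+n≡k) vk≡) (sym previous) (edge-sym (edge-forward (k + N)))
        where
        open mod-Reasoning
        k+n≡k : suc (k + N) ≡ k [mod n ]
        k+n≡k = begin
          suc (k + N)  ≡⟨ +-suc k N ⟨
          k + n        ≡⟨ cong (k +_) (*-identityˡ n) ⟨
          k + 1 * n    ≈⟨ mod-+-multiple k 1 ⟩
          k            ∎
        mirror-step : reflect n j (v (suc i)) + E ≡ reflect n j (v i) [mod n ]
        mirror-step = mod-+-cancelʳ (v i) (begin
          reflect n j (v (suc i)) + E + v i    ≡⟨ +-assoc (reflect n j (v (suc i))) E (v i) ⟩
          reflect n j (v (suc i)) + (E + v i)  ≡⟨ cong (reflect n j (v (suc i)) +_) (+-comm E (v i)) ⟩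
          reflect n j (v (suc i)) + (v i + E)  ≈⟨ mod-+-cong (mod-refl {a = reflect n j (v (suc i))}) (v-step i) ⟩
          reflect n j (v (suc i)) + v (suc i)  ≈⟨ reflect-mod j (v-< (suc i)) ⟩
          j                                    ≈⟨ reflect-mod j (v-< i) ⟨
          reflect n j (v i) + v i              ∎)
        previous : reflect n j (v (suc i)) ≡ v (k + N)
        previous = mod-<⇒≡ (reflect-< j (v (suc i))) (v-< (k + N)) (mod-+-cancelʳ E (begin
          reflect n j (v (suc i)) + E  ≈⟨ mirror-step ⟩
          reflect n j (v i)            ≡⟨ vk≡ ⟨
          v k                          ≡⟨ v-cong k+n≡k ⟨
          v (suc (k + N))              ≈⟨ v-step (k + N) ⟨
          v (k + N) + E                ∎))

    reflects-edge : ∀ x y → x < n → y < n → IsEdge σ x y → IsEdge σ (reflect n j x) (reflect n j y)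
    reflects-edge x y _ _ (i , _ , inj₁ (vi≡x , vi+1≡y)) =
      subst₂ (λ p q → IsEdge σ (reflect n j p) (reflect n j q)) vi≡x vi+1≡y (mirror-edge i)
    reflects-edge x y _ _ (i , _ , inj₂ (vi≡y , vi+1≡x)) =
      edge-sym (subst₂ (λ p q → IsEdge σ (reflect n j p) (reflect n j q)) vi≡y vi+1≡x (mirror-edge i))

  translates-involutive : ∀ {f d} → Translates f d → (∀ x → x < n → f (f x) ≡ x) → d + (d + 0) ≡ 0 [mod n ]
  translates-involutive {f} {d} translates involutive = v-injective (begin
    v (d + (d + 0))  ≡⟨ translates (d + 0) ⟨
    f (v (d + 0))    ≡⟨ cong f (translates 0) ⟨
    f (f (v 0))      ≡⟨ involutive (v 0) (v-< 0) ⟩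
    v 0              ∎)
    where open ≡-Reasoning

  rotation-by-one⇒constant-sides : 2 < n → PreservedBy σ (rotate n 1) → ∀ i → e i ≡ e 0
  rotation-by-one⇒constant-sides 2<n preserved i = constant (rotation-translates 2<n 1 (s≤s z≤n) 2<n preserved)
    where
    constant : ∃[ d ] Translates (rotate n 1) d → e i ≡ e 0
    constant (d , translates) = trans (e-cong (mod-sym reaches-i)) (e-translate-multiple translates T 0)
      where
      open mod-Reasoning
      T : ℕ
      T = v i + n ∸ v 0
      reaches-i : T * d + 0 ≡ i [mod n ]
      reaches-i = v-injective (mod-<⇒≡ (v-< (T * d + 0)) (v-< i) (begin
        v (T * d + 0)  ≈⟨ v-translate-multiple translates T 0 ⟩
        v 0 + T * 1    ≡⟨ cong (v 0 +_) (*-identityʳ T) ⟩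
        v 0 + T        ≡⟨ +-comm (v 0) T ⟩
        T + v 0        ≡⟨ m∸n+n≡m (≤-trans (<⇒≤ (v-< 0)) (m≤n+m n (v i))) ⟩
        v i + n        ≡⟨ cong (v i +_) (*-identityˡ n) ⟨
        v i + 1 * n    ≈⟨ mod-+-multiple (v i) 1 ⟩
        v i            ∎))

  module ThreeFold (m : ℕ) (n≡3m : n ≡ 3 * m) (2<m : 2 < m) where

    instance
      m-nonZero : NonZero m
      m-nonZero = >-nonZero (≤-trans (s≤s z≤n) 2<m)

    9≤n : 9 ≤ n
    9≤n = subst (9 ≤_) (sym n≡3m) (*-monoʳ-≤ 3 2<m)

    2<n : 2 < n
    2<n = ≤-trans (s≤s (s≤s (s≤s z≤n))) 9≤n

    6<n : 6 < n
    6<n = ≤-trans (s≤s (s≤s (s≤s (s≤s (s≤s (s≤s (s≤s z≤n))))))) 9≤n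

    m<n : m < n
    m<n = subst (m <_) (sym n≡3m) (subst (m <_) (*-comm m 3) (m<m*n m 3 (s≤s (s≤s z≤n))))

    mod-n⇒mod-3m : ∀ {a b} → a ≡ b [mod n ] → a ≡ b [mod 3 * m ]
    mod-n⇒mod-3m {a} {b} = subst (λ k → a ≡ b [mod k ]) n≡3m

    mod-3m⇒mod-n : ∀ {a b} → a ≡ b [mod 3 * m ] → a ≡ b [mod n ]
    mod-3m⇒mod-n {a} {b} = subst (λ k → a ≡ b [mod k ]) (sym n≡3m)

    -- The translation has order m on positions, as the rotation by 3 has order m on vertices; hence it generates 3ℤ/nℤ.
    translation-by-3 : ∀ {d} → Translates (rotate n 3) d → ∃[ T ] T * d ≡ 3 [mod n ]
    translation-by-3 {d} translates = scale-by-3 inverse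
      where
      full-turn : m * d + 0 ≡ 0 [mod n ]
      full-turn = v-injective (mod-<⇒≡ (v-< (m * d + 0)) (v-< 0) (begin
        v (m * d + 0)  ≈⟨ v-translate-multiple translates m 0 ⟩
        v 0 + m * 3    ≡⟨ cong (v 0 +_) (trans (*-comm m 3) (trans (sym n≡3m) (sym (*-identityˡ n)))) ⟩
        v 0 + 1 * n    ≈⟨ mod-+-multiple (v 0) 1 ⟩
        v 0            ∎))
        where open mod-Reasoning

      3∣d : 3 ∣ d
      3∣d = m%n≡0⇒n∣m d 3 (mod⇒%≡ (mod-*-unscale m (subst₂ (λ x k → x ≡ m * 0 [mod k ]) (+-identityʳ (m * d)) (*-comm 3 m)
              (mod-n⇒mod-3m (mod-trans full-turn (mod-reflexive (sym (*-zeroʳ m))))))))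

      q : ℕ
      q = _∣_.quotient 3∣d

      times-d : ∀ a → 3 * (a * q) ≡ a * d
      times-d a = begin
        3 * (a * q)  ≡⟨ regroup a q ⟩
        a * (q * 3)  ≡⟨ cong (a *_) (_∣_.equality 3∣d) ⟨
        a * d        ∎
        where
        open ≡-Reasoning
        regroup : ∀ a q → 3 * (a * q) ≡ a * (q * 3)
        regroup = solve-∀

      times-q-cancel : ∀ a b → a < m → b < m → a * q ≡ b * q [mod m ] → a ≡ b
      times-q-cancel a b a<m b<m aq≡bq = mod-<⇒≡ a<m b<m (mod-*-unscale 3 (mod-n⇒mod-3m (begin
        3 * a             ≡⟨ *-comm 3 a ⟩
        a * 3             ≈⟨ mod-+-cancelˡ (v 0) (begin
          v 0 + a * 3       ≈⟨ v-translate-multiple translates a 0 ⟨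
          v (a * d + 0)     ≡⟨ v-cong (mod-+-cong ad≡bd (mod-refl {a = 0})) ⟩
          v (b * d + 0)     ≈⟨ v-translate-multiple translates b 0 ⟩
          v 0 + b * 3       ∎) ⟩
        b * 3             ≡⟨ *-comm b 3 ⟩
        3 * b             ∎)))
        where
        open mod-Reasoning
        ad≡bd : a * d ≡ b * d [mod n ]
        ad≡bd = mod-3m⇒mod-n (subst₂ (λ x y → x ≡ y [mod 3 * m ]) (times-d a) (times-d b) (mod-*-scale 3 aq≡bq))

      inverse : ∃[ T ] T * q ≡ 1 [mod m ]
      inverse = mod-invertible m q (≤-trans (s≤s (s≤s z≤n)) 2<m) times-q-cancel

      scale-by-3 : ∃[ T ] T * q ≡ 1 [mod m ] → ∃[ T ] T * d ≡ 3 [mod n ]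
      scale-by-3 (T , Tq≡1) = T , mod-3m⇒mod-n (subst₂ (λ x y → x ≡ y [mod 3 * m ]) (times-d T) refl (mod-*-scale 3 Tq≡1))

    period-3 : PreservedBy σ (rotate n 3) → ∀ i → e (3 + i) ≡ e i
    period-3 preserved i = shift (rotation-translates 2<n 3 (s≤s z≤n) 6<n preserved)
      where
      shift : ∃[ d ] Translates (rotate n 3) d → e (3 + i) ≡ e i
      shift (d , translates) = generate (translation-by-3 {d} translates)
        where
        generate : ∃[ T ] T * d ≡ 3 [mod n ] → e (3 + i) ≡ e i
        generate (T , T*d≡3) = begin
          e (3 + i)      ≡⟨ e-cong (mod-+-cong (mod-sym T*d≡3) (mod-refl {a = i})) ⟩
          e (T * d + i)  ≡⟨ e-translate-multiple {d = d} translates T i ⟩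
          e i            ∎
          where open ≡-Reasoning

    circular-sides : (∀ j → j < n → ¬ IsAxis σ j) → PreservedBy σ (rotate n 3) →
                     ∃[ a ] ∃[ b ] ∃[ c ] ∃[ s ] (s < n × a ≢ b × a ≢ c × SidesFrom σ s a b c)
    circular-sides no-axis preserved = from (distinct-in-block not-constant)
      where
      open Periodic e (period-3 preserved)
      not-constant : ¬ (e 0 ≡ e 1 × e 0 ≡ e 2)
      not-constant (e0≡e1 , e0≡e2) =
        no-axis 0 (≤-trans (s≤s z≤n) 2<n) (constant-sides⇒axis (e 0) (periodic-constant 0 e0≡e1 e0≡e2) 0)
      from : ∃[ s ] (s < 3 × e s ≢ e (1 + s) × e s ≢ e (2 + s)) →
             ∃[ a ] ∃[ b ] ∃[ c ] ∃[ s ] (s < n × a ≢ b × a ≢ c × SidesFrom σ s a b c)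
      from (s , s<3 , ab , ac) = e s , e (1 + s) , e (2 + s) , s , <-≤-trans s<3 2<n , ab , ac , λ i _ → periodic⇒blk s i

    module _ (S : Subset n) (axes : ∀ (j : Fin n) → j ∈ S ⇔ IsAxis σ (toℕ j)) where

      all-axes : ∣ S ∣ ≡ n → ∀ j → j < n → IsAxis σ j
      all-axes full j j<n = subst (IsAxis σ) (toℕ-fromℕ< j<n)
        (Equivalence.to (axes (fromℕ< j<n)) (subst (fromℕ< j<n ∈_) (sym (∣p∣≡n⇒p≡⊤ full)) ∈⊤))

      module MAxes (m-axes : ∣ S ∣ ≡ m) where

        axis? : Decidable (IsAxis σ)
        axis? t = map′
          (λ t∈S → axis-cong (%-mod t) (subst (IsAxis σ) (toℕ-fromℕ< _) (Equivalence.to (axes (t mod n)) t∈S)))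
          (λ t-axis → Equivalence.from (axes (t mod n)) (subst (IsAxis σ) (sym (toℕ-fromℕ< _)) (axis-cong (mod-sym (%-mod t)) t-axis)))
          ((t mod n) ∈? S)

        some-axis : ∃[ a ] IsAxis σ a
        some-axis = from (nonempty? S)
          where
          from : Dec (Nonempty S) → ∃[ a ] IsAxis σ a
          from (yes (j , j∈S)) = toℕ j , Equivalence.to (axes j) j∈S
          from (no empty)      = ⊥-elim (<-irrefl (trans (sym (∣⊥∣≡0 n)) (trans (cong ∣_∣ (sym (Empty-unique empty))) m-axes))
                                                  (≤-trans (s≤s z≤n) 2<m))

        a₀ : ℕ
        a₀ = proj₁ some-axis

        a₀-axis : IsAxis σ a₀
        a₀-axis = proj₂ some-axis

        a₀+n-axis : IsAxis σ (a₀ + n)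
        a₀+n-axis = axis-cong (mod-trans (mod-sym (mod-+-multiple a₀ 1)) (mod-reflexive (cong (a₀ +_) (*-identityˡ n)))) a₀-axis

        gap-search : ∃[ g ] (IsAxis σ (a₀ + suc g) × ∀ t → t < g → ¬ IsAxis σ (a₀ + suc t))
        gap-search = least-witness (λ t → axis? (a₀ + suc t)) N a₀+n-axis

        -- the least positive h such that a₀ + h is an axis
        h : ℕ
        h = suc (proj₁ gap-search)

        a₀+h-axis : IsAxis σ (a₀ + h)
        a₀+h-axis = proj₁ (proj₂ gap-search)

        axis-multiple : ∀ k → IsAxis σ (a₀ + k * h)
        axis-multiple zero    = axis-cong (mod-reflexive (sym (+-identityʳ a₀))) a₀-axis
        axis-multiple (suc k) = axis-cong (mod-trans (mod-reflexive (regroup a₀ k h N)) (mod-+-multiple (a₀ + (h + k * h)) a₀))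
                                  (axis-reflect (a₀ + k * h) a₀ (a₀ + h) (axis-multiple k) a₀-axis a₀+h-axis)
          where
          regroup : ∀ a₀ k h N → a₀ + k * h + (a₀ + h) + N * a₀ ≡ a₀ + (h + k * h) + a₀ * suc N
          regroup = solve-∀

        axis⇒gap∣ : ∀ t → IsAxis σ (a₀ + t) → h ∣ t
        axis⇒gap∣ t t-axis = remainder-zero (t % h) (m%n<n t h) (m≡m%n+[m/n]*n t h) remainder-axis
          where
          remainder-axis : IsAxis σ (a₀ + t % h)
          remainder-axis = axis-cong
            (mod-trans (mod-reflexive (trans (cong (λ z → a₀ + z + a₀ + N * (a₀ + t / h * h)) (m≡m%n+[m/n]*n t h))
                                             (regroup a₀ (t % h) (t / h * h) N)))
                       (mod-+-multiple (a₀ + t % h) (a₀ + t / h * h)))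
            (axis-reflect (a₀ + t) (a₀ + t / h * h) a₀ t-axis (axis-multiple (t / h)) a₀-axis)
            where
            regroup : ∀ a₀ r Q N → a₀ + (r + Q) + a₀ + N * (a₀ + Q) ≡ a₀ + r + (a₀ + Q) * suc N
            regroup = solve-∀
          remainder-zero : ∀ r → r < h → t ≡ r + t / h * h → IsAxis σ (a₀ + r) → h ∣ t
          remainder-zero zero    _           t≡ _      = divides (t / h) t≡
          remainder-zero (suc r) (s≤s r<h-1) _  r-axis = ⊥-elim (proj₂ (proj₂ gap-search) r r<h-1 r-axis)

        axis⇔gap∣ : ∀ j → IsAxis σ j ⇔ h ∣ j + N * a₀
        axis⇔gap∣ j = mk⇔
          (λ j-axis → axis⇒gap∣ (j + N * a₀) (axis-cong (mod-sym j≡) j-axis))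
          (λ { (divides k eq) → axis-cong (mod-trans (mod-reflexive (cong (a₀ +_) (sym eq))) j≡) (axis-multiple k) })
          where
          regroup : ∀ a₀ j N → a₀ + (j + N * a₀) ≡ j + a₀ * suc N
          regroup = solve-∀
          j≡ : a₀ + (j + N * a₀) ≡ j [mod n ]
          j≡ = mod-trans (mod-reflexive (regroup a₀ j N)) (mod-+-multiple j a₀)

        -- The axes are the j with h ∣ j - a₀: there are n / h of them, and m by hypothesis.
        h≡3 : h ≡ 3
        h≡3 = from-quotient (axis⇒gap∣ n a₀+n-axis)
          where
          from-quotient : h ∣ n → h ≡ 3
          from-quotient (divides k n≡k*h) = *-cancelˡ-≡ h 3 m (begin
            m * h  ≡⟨ cong (_* h) m≡k ⟩
            k * h  ≡⟨ n≡k*h ⟨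
            n      ≡⟨ n≡3m ⟩
            3 * m  ≡⟨ *-comm 3 m ⟩
            m * 3  ∎)
            where
            open ≡-Reasoning
            divisible? : Decidable (λ j → h ∣ j + N * a₀)
            divisible? j = h ∣? (j + N * a₀)
            m≡k : m ≡ k
            m≡k = begin
              m                          ≡⟨ m-axes ⟨
              ∣ S ∣                      ≡⟨ ∣S∣≡count S divisible? (λ j → mk⇔
                                              (Equivalence.to (axis⇔gap∣ (toℕ j)) ∘ Equivalence.to (axes j))
                                              (Equivalence.from (axes j) ∘ Equivalence.from (axis⇔gap∣ (toℕ j)))) ⟩
              count divisible? n         ≡⟨ cong (count divisible?) n≡k*h ⟩
              count divisible? (k * h)   ≡⟨ count-divisible h (N * a₀) k ⟩
              k                          ∎

        a₀+3-axis : IsAxis σ (a₀ + 3)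
        a₀+3-axis = subst (λ z → IsAxis σ (a₀ + z)) (trans (*-identityˡ h) h≡3) (axis-multiple 1)

        rotation-by-3 : PreservedBy σ (rotate n 3)
        rotation-by-3 = rotation-from-axes a₀ 3 a₀-axis a₀+3-axis

        -- If both reflections translated positions, so would their composite, the rotation by 3, with twice its shift ≡ 0.
        some-axis-reverses : ∃[ a ] ∃[ d ] Reverses (reflect n a) d
        some-axis-reverses = choose (acts-on-positions (λ x _ → reflect-< a₀ x) (reflect-injective a₀) a₀-axis 2<n)
                                    (acts-on-positions (λ x _ → reflect-< (a₀ + 3) x) (reflect-injective (a₀ + 3)) a₀+3-axis 2<n)
          where
          choose : ∃[ d ] (Translates (reflect n a₀) d ⊎ Reverses (reflect n a₀) d) →
                   ∃[ d ] (Translates (reflect n (a₀ + 3)) d ⊎ Reverses (reflect n (a₀ + 3)) d) →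
                   ∃[ a ] ∃[ d ] Reverses (reflect n a) d
          choose (d₀ , inj₂ reverses) _                      = a₀ , d₀ , reverses
          choose (d₀ , inj₁ _)        (d₁ , inj₂ reverses)   = a₀ + 3 , d₁ , reverses
          choose (d₀ , inj₁ t₀)       (d₁ , inj₁ t₁)         =
            ⊥-elim (≢0-mod (s≤s z≤n) 6<n (rotate-twice-fixes 3 (v 0) (v-< 0) rotate-twice))
            where
            rotate-v : ∀ i → rotate n 3 (v i) ≡ v (d₁ + (d₀ + i))
            rotate-v i = begin
              rotate n 3 (v i)                         ≡⟨ reflect∘reflect a₀ 3 (v i) (v-< i) ⟨
              reflect n (a₀ + 3) (reflect n a₀ (v i))  ≡⟨ cong (reflect n (a₀ + 3)) (t₀ i) ⟩
              reflect n (a₀ + 3) (v (d₀ + i))          ≡⟨ t₁ (d₀ + i) ⟩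
              v (d₁ + (d₀ + i))                        ∎
              where open ≡-Reasoning
            twice : d₁ + (d₀ + (d₁ + (d₀ + 0))) ≡ 0 [mod n ]
            twice = mod-trans (mod-reflexive (regroup d₀ d₁))
                      (mod-+-cong (translates-involutive {reflect n a₀} {d₀} t₀ (reflect-involutive a₀))
                                  (translates-involutive {reflect n (a₀ + 3)} {d₁} t₁ (reflect-involutive (a₀ + 3))))
              where
              regroup : ∀ d₀ d₁ → d₁ + (d₀ + (d₁ + (d₀ + 0))) ≡ d₀ + (d₀ + 0) + (d₁ + (d₁ + 0))
              regroup = solve-∀
            rotate-twice : rotate n 3 (rotate n 3 (v 0)) ≡ v 0
            rotate-twice = begin
              rotate n 3 (rotate n 3 (v 0))    ≡⟨ cong (rotate n 3) (rotate-v 0) ⟩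
              rotate n 3 (v (d₁ + (d₀ + 0)))   ≡⟨ rotate-v (d₁ + (d₀ + 0)) ⟩
              v (d₁ + (d₀ + (d₁ + (d₀ + 0))))  ≡⟨ v-cong twice ⟩
              v 0                              ∎
              where open ≡-Reasoning

        axial-sides : ∃[ a ] ∃[ b ] ∃[ c ] ∃[ s ] (s < n × a ≢ b × a ≡ c × SidesFrom σ s a b c)
        axial-sides = from some-axis-reverses
          where
          open Periodic e (period-3 rotation-by-3)
          from : ∃[ a ] ∃[ d ] Reverses (reflect n a) d → ∃[ a ] ∃[ b ] ∃[ c ] ∃[ s ] (s < n × a ≢ b × a ≡ c × SidesFrom σ s a b c)
          from (a , d , reverses) = e s , e (1 + s) , e (2 + s) , s % n , m%n<n s n , a≢b , a≡c ,
                                    λ i _ → trans (e-cong (mod-+-cong (%-mod s) (mod-refl {a = i}))) (periodic⇒blk s i)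
            where
            -- The reversal gives e (d - 1 - i) ≡ e i, and for i = 2d the position d - 1 - i is 2 + 2d modulo 3.
            s : ℕ
            s = d + d
            a≡c : e s ≡ e (2 + s)
            a≡c = begin
              e s                            ≡⟨ e-reverse {a} {d} reverses s ⟨
              e (d + N * suc s)              ≡⟨ e-cong (d + 2 , 0 , wrap d N) ⟩
              e (N * (d + 1) * 3 + (2 + s))  ≡⟨ periodic-multiple (N * (d + 1)) (2 + s) ⟩
              e (2 + s)                      ∎
              where
              open ≡-Reasoning
              wrap : ∀ d N → d + N * suc (d + d) + (d + 2) * suc N ≡ N * (d + 1) * 3 + (2 + (d + d)) + 0 * suc N
              wrap = solve-∀
            a≢b : e s ≢ e (1 + s)
            a≢b a≡b = <-irrefl m≡n m<n
              where
              every-axis : ∀ j → IsAxis σ j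
              every-axis = constant-sides⇒axis (e s) (periodic-constant s a≡b a≡c)
              m≡n : m ≡ n
              m≡n = begin
                m          ≡⟨ m-axes ⟨
                ∣ S ∣      ≡⟨ cong ∣_∣ (⊆-antisym ⊆⊤ (λ {j} _ → Equivalence.from (axes j) (every-axis (toℕ j)))) ⟩
                ∣ ⊤ {n} ∣  ≡⟨ ∣⊤∣≡n n ⟩
                n          ∎
                where open ≡-Reasoning

    regular-sides : (∀ j → j < n → IsAxis σ j) → ∀ i → e i ≡ e 0
    regular-sides every-axis = rotation-by-one⇒constant-sides 2<n
      (rotation-from-axes 0 1 (every-axis 0 (≤-trans (s≤s z≤n) 2<n)) (every-axis 1 (≤-trans (s≤s (s≤s z≤n)) 2<n)))

lemma1 : ∀ (m : ℕ) → 2 < m → (σ : Fin (3 * m) → Fin (3 * m)) → IsPolygon σ →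
    (Circular m σ → ∃[ a ] ∃[ b ] ∃[ c ] ∃[ s ] (s < 3 * m × a ≢ b × a ≢ c × SidesFrom σ s a b c))
    × (Axial m σ → ∃[ a ] ∃[ b ] ∃[ c ] ∃[ s ] (s < 3 * m × a ≢ b × a ≡ c × SidesFrom σ s a b c))
    × (CompletelyRegular m σ → ∃[ a ] ∃[ b ] ∃[ c ] (a ≡ b × b ≡ c × SidesFrom σ 0 a b c))
lemma1 .(3 + k) 2<m@(s≤s (s≤s (s≤s {n = k} _))) σ polygon = circular , axial , regular
  where
  open Polygon σ polygon
  open ThreeFold (3 + k) refl 2<m

  circular : Circular (3 + k) σ → ∃[ a ] ∃[ b ] ∃[ c ] ∃[ s ] (s < n × a ≢ b × a ≢ c × SidesFrom σ s a b c)
  circular (no-axis , rotations) = circular-sides no-axis (rotations 1 (s≤s z≤n) (s≤s z≤n))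

  axial : Axial (3 + k) σ → ∃[ a ] ∃[ b ] ∃[ c ] ∃[ s ] (s < n × a ≢ b × a ≡ c × SidesFrom σ s a b c)
  axial (S , axes , m-axes) = MAxes.axial-sides S axes m-axes

  regular : CompletelyRegular (3 + k) σ → ∃[ a ] ∃[ b ] ∃[ c ] (a ≡ b × b ≡ c × SidesFrom σ 0 a b c)
  regular (S , axes , n-axes) =
    e 0 , e 0 , e 0 , refl , refl , λ i _ → trans (regular-sides (all-axes S axes n-axes) i) (sym (blk-constant (e 0) i))
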